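{- For every integer $n\geq2$, $$p_{n,n}(n)=p_{n,n-1}(n)=p(n)-1.$$
   Context: A partition of $n$ is a finite multiset of positive integers summing to $n$; $p(n)$ is the number of partitions of $n$. For positive integers $A,a$ and a partition $\pi$, $\mathrm{mex}_{A,a}(\pi)$ is the smallest element of $\{a,a+A,a+2A,\dots\}$ that is not a part of $\pi$. $p_{A,a}(n)$ is the number of partitions $\pi$ of $n$ with $\mathrm{mex}_{A,a}(\pi)\equiv a \pmod{2A}$. -}

module Defs where

open import Data.Nat using (ℕ; zero; suc; _+_; _*_; _∸_; _≥_; _≤_; _≤?_; _≥?_; _≟_; _≡ᵇ_)
open import Data.Nat.Divisibility using (_∣_; _∣?_)
open import Data.List using (List; []; _∷_; [_]; map; concatMap; upTo; length; filter)
open import Data.Nat.ListAction using (sum)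
open import Data.Bool.ListAction using (any)
open import Data.List.Relation.Unary.All using (All; all?)
open import Data.List.Relation.Unary.Linked using (Linked; linked?)
open import Data.Product using (_×_)
open import Data.Bool using (if_then_else_)
open import Relation.Binary.PropositionalEquality using (_≡_)
open import Relation.Nullary.Decidable using (Dec; _×-dec_)

-- A partition of n is represented canonically (as a multiset) by the
-- non-increasing list of its parts: all parts positive, summing to n.
IsPartition : ℕ → List ℕ → Set
IsPartition n xs = All (1 ≤_) xs × Linked _≥_ xs × sum xs ≡ n

isPartition? : (n : ℕ) → (xs : List ℕ) → Dec (IsPartition n xs)
isPartition? n xs = all? (1 ≤?_) xs ×-dec (linked? _≥?_ xs ×-dec (sum xs ≟ n))

listsOf : ℕ → ℕ → List (List ℕ)
listsOf m zero = [ [] ]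
listsOf m (suc k) = concatMap (λ x → map (x ∷_) (listsOf m k)) (map suc (upTo m))

-- all lists of length ≤ n with entries in {1, …, n}; every partition of n
-- (as a list) is among them
candidates : ℕ → List (List ℕ)
candidates n = concatMap (listsOf n) (upTo (suc n))

partitions : ℕ → List (List ℕ)
partitions n = filter (isPartition? n) (candidates n)

p : ℕ → ℕ
p n = length (partitions n)

isPart : ℕ → List ℕ → _
isPart c π = any (λ x → x ≡ᵇ c) π

mexAux : ℕ → ℕ → List ℕ → ℕ → ℕ → ℕ
mexAux A a π zero k = a + A * k
mexAux A a π (suc f) k =
  if isPart (a + A * k) π then mexAux A a π f (suc k) else a + A * k

-- mex_{A,a}(π): the smallest element of {a, a+A, a+2A, …} that is not a part
-- of π.  For A ≥ 1 the length π + 1 candidates a, …, a + A·(length π) are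
-- distinct, so one of them is not a part; hence fuel length π suffices.
mex : ℕ → ℕ → List ℕ → ℕ
mex A a π = mexAux A a π (length π) 0

-- mex_{A,a}(π) ≡ a (mod 2A); since mex ≥ a this is 2A ∣ mex − a
MexCond : ℕ → ℕ → List ℕ → Set
MexCond A a π = (2 * A) ∣ (mex A a π ∸ a)

mexCond? : (A a : ℕ) → (π : List ℕ) → Dec (MexCond A a π)
mexCond? A a π = (2 * A) ∣? (mex A a π ∸ a)

pMex : ℕ → ℕ → ℕ → ℕ
pMex A a n = length (filter (mexCond? A a) (partitions n))

{-# OPTIONS --safe #-}
module Submission where

-- If a is not a part of π, then mex_{A,a}(π) = a, which satisfies the congruence.
-- For A = n and a ∈ {n, n − 1} we have n ≤ 2a, so a part equal to a must be the
-- largest part, and this forces π = (n), respectively π = (n − 1, 1).  There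
-- a + A > n is not a part, so the mex is a + A ≢ a (mod 2A).  Hence exactly one
-- partition of n fails the condition.

open import Defs
open import Data.Bool using (true; false)
open import Data.Bool.Properties using (T-≡)
open import Data.List using (List; []; _∷_; [_]; _++_; map; concatMap; upTo; length; filter)
open import Data.List.Membership.Propositional using (_∈_; _∉_)
open import Data.List.Properties using (≡-dec; length-++; filter-++; map-upTo; ∷-injectiveˡ; ∷-injectiveʳ)
open import Data.List.Relation.Unary.All as All using (All; []; _∷_)
open import Data.List.Relation.Unary.All.Properties using (all-filter)
open import Data.List.Relation.Unary.Any as Any using (here; there)
open import Data.List.Relation.Unary.Any.Properties using (any⁺; any⁻)
open import Data.List.Relation.Unary.Linked using (Linked; [-]; _∷_)
open import Data.List.Relation.Unary.Linked.Properties using (Linked⇒All)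
open import Data.Nat using (ℕ; zero; suc; _+_; _*_; _∸_; _≤_; _<_; _≥_; z≤n; s≤s; z<s; _≡ᵇ_; _≟_; >-nonZero)
open import Data.Nat.Divisibility using (_∣_; _∣0; >⇒∤)
open import Data.Nat.ListAction using (sum)
open import Data.Nat.Properties
open import Data.List.Membership.DecPropositional _≟_ using (_∈?_)
open import Data.Product using (_×_; _,_)
open import Function using (_∘_; Injective)
open import Function.Bundles using (Equivalence)
open import Relation.Binary.Definitions using (DecidableEquality)
open import Relation.Binary.PropositionalEquality
  using (_≡_; _≢_; refl; sym; trans; subst; cong; cong₂; module ≡-Reasoning)
open import Relation.Nullary using (¬_; yes; no; contradiction)
open import Relation.Unary using (Decidable)

open ≡-Reasoning

count : {A : Set} → DecidableEquality A → A → List A → ℕ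
count _≟ᴬ_ x xs = length (filter (x ≟ᴬ_) xs)

module _ {A : Set} (_≟ᴬ_ : DecidableEquality A) where

  count-++ : ∀ x xs ys → count _≟ᴬ_ x (xs ++ ys) ≡ count _≟ᴬ_ x xs + count _≟ᴬ_ x ys
  count-++ x xs ys = trans (cong length (filter-++ (x ≟ᴬ_) xs ys)) (length-++ (filter (x ≟ᴬ_) xs))

  count-filter : {Q : A → Set} (Q? : Decidable Q) {x : A} → Q x →
                 ∀ xs → count _≟ᴬ_ x (filter Q? xs) ≡ count _≟ᴬ_ x xs
  count-filter Q? qx [] = refl
  count-filter Q? {x} qx (y ∷ ys) with Q? y
  ... | yes _ with x ≟ᴬ y
  ...   | yes _ = cong suc (count-filter Q? qx ys)
  ...   | no _  = count-filter Q? qx ys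
  count-filter Q? {x} qx (y ∷ ys) | no ¬qy with x ≟ᴬ y
  ...   | yes refl = contradiction qx ¬qy
  ...   | no _     = count-filter Q? qx ys

  length-filter+count : {P : A → Set} (P? : Decidable P) {x₀ : A} → ¬ P x₀ →
                        ∀ xs → All (λ y → ¬ P y → y ≡ x₀) xs →
                        length (filter P? xs) + count _≟ᴬ_ x₀ xs ≡ length xs
  length-filter+count P? ¬px₀ [] [] = refl
  length-filter+count P? {x₀} ¬px₀ (y ∷ ys) (only-x₀ ∷ rest) with P? y
  ... | yes py with x₀ ≟ᴬ y
  ...   | yes refl = contradiction py ¬px₀
  ...   | no _     = cong suc (length-filter+count P? ¬px₀ ys rest)
  length-filter+count P? {x₀} ¬px₀ (y ∷ ys) (only-x₀ ∷ rest) | no ¬py with x₀ ≟ᴬ y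
  ...   | yes _  = trans (+-suc _ _) (cong suc (length-filter+count P? ¬px₀ ys rest))
  ...   | no x₀≢y = contradiction (sym (only-x₀ ¬py)) x₀≢y

  count-map-outside : ∀ {B : Set} (f : B → A) {y : A} → (∀ z → f z ≢ y) →
                      ∀ zs → count _≟ᴬ_ y (map f zs) ≡ 0
  count-map-outside f y∉im [] = refl
  count-map-outside f {y} y∉im (z ∷ zs) with y ≟ᴬ f z
  ... | yes y≡fz = contradiction (sym y≡fz) (y∉im z)
  ... | no _     = count-map-outside f y∉im zs

  count-map-injective : ∀ {B : Set} (_≟ᴮ_ : DecidableEquality B) (f : B → A) →
                        Injective _≡_ _≡_ f →
                        ∀ x zs → count _≟ᴬ_ (f x) (map f zs) ≡ count _≟ᴮ_ x zs
  count-map-injective _≟ᴮ_ f f-inj x [] = refl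
  count-map-injective _≟ᴮ_ f f-inj x (z ∷ zs) with f x ≟ᴬ f z | x ≟ᴮ z
  ... | yes _      | yes _    = cong suc (count-map-injective _≟ᴮ_ f f-inj x zs)
  ... | yes fx≡fz  | no x≢z   = contradiction (f-inj fx≡fz) x≢z
  ... | no fx≢fz   | yes refl = contradiction refl fx≢fz
  ... | no _       | no _     = count-map-injective _≟ᴮ_ f f-inj x zs

  count-concatMap : ∀ {B : Set} (_≟ᴮ_ : DecidableEquality B) (g : B → List A) {x : A} (y₀ : B) →
                    (∀ y → y ≢ y₀ → count _≟ᴬ_ x (g y) ≡ 0) →
                    ∀ ys → count _≟ᴬ_ x (concatMap g ys) ≡ count _≟ᴬ_ x (g y₀) * count _≟ᴮ_ y₀ ys
  count-concatMap _≟ᴮ_ g {x} y₀ elsewhere [] = sym (*-zeroʳ (count _≟ᴬ_ x (g y₀)))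
  count-concatMap _≟ᴮ_ g {x} y₀ elsewhere (y ∷ ys)
    rewrite count-++ x (g y) (concatMap g ys) with y₀ ≟ᴮ y
  ... | yes refl = trans (cong (count _≟ᴬ_ x (g y₀) +_) (count-concatMap _≟ᴮ_ g y₀ elsewhere ys))
                         (sym (*-suc (count _≟ᴬ_ x (g y₀)) (count _≟ᴮ_ y₀ ys)))
  ... | no y₀≢y  rewrite elsewhere y (y₀≢y ∘ sym) = count-concatMap _≟ᴮ_ g y₀ elsewhere ys

_≟ₗ_ : DecidableEquality (List ℕ)
_≟ₗ_ = ≡-dec _≟_

count-upTo : ∀ {y m} → y < m → count _≟_ y (upTo m) ≡ 1
count-upTo {y} {suc m} y<1+m =
  trans (cong (count _≟_ y ∘ (0 ∷_)) (sym (map-upTo suc m))) (count-0∷map-suc y y<1+m)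
  where
  count-0∷map-suc : ∀ y → y < suc m → count _≟_ y (0 ∷ map suc (upTo m)) ≡ 1
  count-0∷map-suc zero    _         = cong suc (count-map-outside _≟_ suc (λ _ ()) (upTo m))
  count-0∷map-suc (suc y) (s≤s y<m) =
    trans (count-map-injective _≟_ _≟_ suc suc-injective y (upTo m)) (count-upTo y<m)

count-cons-listsOf : ∀ m k y ys →
  count _≟ₗ_ (y ∷ ys) (listsOf m (suc k)) ≡ count _≟ₗ_ ys (listsOf m k) * count _≟_ y (map suc (upTo m))
count-cons-listsOf m k y ys = begin
  count _≟ₗ_ (y ∷ ys) (concatMap cons-onto (map suc (upTo m)))
    ≡⟨ count-concatMap _≟ₗ_ _≟_ cons-onto y other-heads (map suc (upTo m)) ⟩
  count _≟ₗ_ (y ∷ ys) (cons-onto y) * count _≟_ y (map suc (upTo m))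
    ≡⟨ cong (_* count _≟_ y (map suc (upTo m)))
            (count-map-injective _≟ₗ_ _≟ₗ_ (y ∷_) ∷-injectiveʳ ys (listsOf m k)) ⟩
  count _≟ₗ_ ys (listsOf m k) * count _≟_ y (map suc (upTo m)) ∎
  where
  cons-onto : ℕ → List (List ℕ)
  cons-onto x = map (x ∷_) (listsOf m k)
  other-heads : ∀ x → x ≢ y → count _≟ₗ_ (y ∷ ys) (cons-onto x) ≡ 0
  other-heads x x≢y = count-map-outside _≟ₗ_ (x ∷_) (λ _ e → x≢y (∷-injectiveˡ e)) (listsOf m k)

count-listsOf-length : ∀ m k xs → length xs ≢ k → count _≟ₗ_ xs (listsOf m k) ≡ 0
count-listsOf-length m zero    []       len≢0 = contradiction refl len≢0
count-listsOf-length m zero    (_ ∷ _)  _     = refl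
count-listsOf-length m (suc k) []       _     =
  trans (count-concatMap _≟ₗ_ _≟_ (λ x → map (x ∷_) (listsOf m k)) 0 (λ y _ → nil-absent y) (map suc (upTo m)))
        (cong (_* count _≟_ 0 (map suc (upTo m))) (nil-absent 0))
  where
  nil-absent : ∀ x → count _≟ₗ_ [] (map (x ∷_) (listsOf m k)) ≡ 0
  nil-absent x = count-map-outside _≟ₗ_ (x ∷_) (λ _ ()) (listsOf m k)
count-listsOf-length m (suc k) (y ∷ ys) len≢1+k =
  trans (count-cons-listsOf m k y ys)
        (cong (_* count _≟_ y (map suc (upTo m))) (count-listsOf-length m k ys (len≢1+k ∘ cong suc)))

count-listsOf : ∀ m xs → All (λ y → 1 ≤ y × y ≤ m) xs → count _≟ₗ_ xs (listsOf m (length xs)) ≡ 1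
count-listsOf m []           []                        = refl
count-listsOf m (suc y ∷ ys) ((_ , y<m) ∷ in-range) =
  trans (count-cons-listsOf m (length ys) (suc y) ys)
        (cong₂ _*_ (count-listsOf m ys in-range)
                   (trans (count-map-injective _≟_ _≟_ suc suc-injective y (upTo m)) (count-upTo y<m)))

count-candidates : ∀ n xs → All (λ y → 1 ≤ y × y ≤ n) xs → length xs ≤ n → count _≟ₗ_ xs (candidates n) ≡ 1
count-candidates n xs in-range len≤n = begin
  count _≟ₗ_ xs (concatMap (listsOf n) (upTo (suc n)))
    ≡⟨ count-concatMap _≟ₗ_ _≟_ (listsOf n) (length xs) other-lengths (upTo (suc n)) ⟩
  count _≟ₗ_ xs (listsOf n (length xs)) * count _≟_ (length xs) (upTo (suc n))
    ≡⟨ cong₂ _*_ (count-listsOf n xs in-range) (count-upTo (s≤s len≤n)) ⟩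
  1 ∎
  where
  other-lengths : ∀ k → k ≢ length xs → count _≟ₗ_ xs (listsOf n k) ≡ 0
  other-lengths k k≢len = count-listsOf-length n k xs (k≢len ∘ sym)

parts-≤-sum : ∀ xs → All (_≤ sum xs) xs
parts-≤-sum []       = []
parts-≤-sum (x ∷ xs) = m≤m+n x (sum xs) ∷ All.map (λ y≤ → ≤-trans y≤ (m≤n+m (sum xs) x)) (parts-≤-sum xs)

∈⇒≤-sum : ∀ {c xs} → c ∈ xs → c ≤ sum xs
∈⇒≤-sum {xs = xs} = All.lookup (parts-≤-sum xs)

length-≤-sum : ∀ {xs} → All (1 ≤_) xs → length xs ≤ sum xs
length-≤-sum []         = z≤n
length-≤-sum (1≤x ∷ ps) = +-mono-≤ 1≤x (length-≤-sum ps)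

count-partitions : ∀ {n π} → IsPartition n π → count _≟ₗ_ π (partitions n) ≡ 1
count-partitions {n} {π} isP@(positive , _ , refl) =
  trans (count-filter _≟ₗ_ (isPartition? n) isP (candidates n))
        (count-candidates n π (All.zip (positive , parts-≤-sum π)) (length-≤-sum positive))

isPart⇒∈ : ∀ {c π} → isPart c π ≡ true → c ∈ π
isPart⇒∈ {c} {π} eq = Any.map (λ {x} x≡ᵇc → sym (≡ᵇ⇒≡ x c x≡ᵇc)) (any⁻ (_≡ᵇ c) π (Equivalence.from T-≡ eq))

∈⇒isPart : ∀ {c π} → c ∈ π → isPart c π ≡ true
∈⇒isPart {c} c∈π = Equivalence.to T-≡ (any⁺ (_≡ᵇ c) (Any.map (λ {x} c≡x → ≡⇒≡ᵇ x c (sym c≡x)) c∈π))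

module _ {A a : ℕ} where

  a+A*0≡a : a + A * 0 ≡ a
  a+A*0≡a = trans (cong (a +_) (*-zeroʳ A)) (+-identityʳ a)

  mexAux-absent : ∀ {π} f k → a + A * k ∉ π → mexAux A a π f k ≡ a + A * k
  mexAux-absent     zero    k _ = refl
  mexAux-absent {π} (suc f) k ∉π with isPart (a + A * k) π in eq
  ... | true  = contradiction (isPart⇒∈ eq) ∉π
  ... | false = refl

  mexAux-present : ∀ {π} f k → a + A * k ∈ π → mexAux A a π (suc f) k ≡ mexAux A a π f (suc k)
  mexAux-present f k ∈π rewrite ∈⇒isPart ∈π = refl

  mex-absent : ∀ {π} → a ∉ π → mex A a π ≡ a
  mex-absent {π} a∉π = trans (mexAux-absent (length π) 0 (a∉π ∘ subst (_∈ π) a+A*0≡a)) a+A*0≡a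

  mex-second : ∀ {π} → a ∈ π → a + A ∉ π → mex A a π ≡ a + A
  mex-second {x ∷ xs} a∈π a+A∉π = begin
    mexAux A a (x ∷ xs) (suc (length xs)) 0
      ≡⟨ mexAux-present (length xs) 0 (subst (_∈ x ∷ xs) (sym a+A*0≡a) a∈π) ⟩
    mexAux A a (x ∷ xs) (length xs) 1
      ≡⟨ mexAux-absent (length xs) 1 (a+A∉π ∘ subst (_∈ x ∷ xs) a+A*1≡a+A) ⟩
    a + A * 1
      ≡⟨ a+A*1≡a+A ⟩
    a + A ∎
    where
    a+A*1≡a+A : a + A * 1 ≡ a + A
    a+A*1≡a+A = cong (a +_) (*-identityʳ A)

  mexCond-absent : ∀ {π} → a ∉ π → MexCond A a π
  mexCond-absent a∉π rewrite mex-absent a∉π | n∸n≡0 a = (2 * A) ∣0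

  ¬mexCond-second : ∀ {π} → 0 < A → a ∈ π → a + A ∉ π → ¬ MexCond A a π
  ¬mexCond-second 0<A a∈π a+A∉π 2A∣mex∸a =
    >⇒∤ {{>-nonZero 0<A}} (m<m+n A (≤-trans 0<A (m≤m+n A 0)))
        (subst (2 * A ∣_) (trans (cong (_∸ a) (mex-second a∈π a+A∉π)) (m+n∸m≡n a A)) 2A∣mex∸a)

sorted⇒≤-head : ∀ {x xs} → Linked _≥_ (x ∷ xs) → All (_≤ x) (x ∷ xs)
sorted⇒≤-head = Linked⇒All (λ x≥y y≥z → ≤-trans y≥z x≥y) ≤-refl

large-part-is-largest : ∀ {n x xs c} → IsPartition n (x ∷ xs) → c ∈ x ∷ xs → n ≤ c + c → x ≡ c
large-part-is-largest _ (here refl) _ = refl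
large-part-is-largest {x = x} {xs} {c} (_ , sorted , refl) (there c∈xs) n≤2c with x ≟ c
... | yes x≡c = x≡c
... | no  x≢c = contradiction 2c<2c (<-irrefl refl)
  where
  c<x : c < x
  c<x = ≤∧≢⇒< (All.lookup (sorted⇒≤-head sorted) (there c∈xs)) (x≢c ∘ sym)
  2c<2c : c + c < c + c
  2c<2c = <-≤-trans (+-monoˡ-< c c<x) (≤-trans (+-monoʳ-≤ x (∈⇒≤-sum c∈xs)) n≤2c)

positive-sum≡0 : ∀ {xs} → All (1 ≤_) xs → sum xs ≡ 0 → xs ≡ []
positive-sum≡0 []          _  = refl
positive-sum≡0 (s≤s _ ∷ _) ()

positive-sum≡1 : ∀ {xs} → All (1 ≤_) xs → sum xs ≡ 1 → xs ≡ [ 1 ]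
positive-sum≡1 {1 ∷ _}           (_ ∷ positive) sum≡1 = cong (1 ∷_) (positive-sum≡0 positive (suc-injective sum≡1))
positive-sum≡1 {suc (suc _) ∷ _} _              ()

partition-with-part-n : ∀ {n π} → IsPartition n π → n ∈ π → π ≡ [ n ]
partition-with-part-n {n} {x ∷ xs} isP@(_ ∷ positive , _ , sum≡n) n∈π
  with large-part-is-largest isP n∈π (m≤m+n n n)
... | refl = cong (x ∷_) (positive-sum≡0 positive (+-cancelˡ-≡ x (sum xs) 0 (trans sum≡n (sym (+-identityʳ x)))))

partition-with-part-n∸1 : ∀ {m π} → IsPartition (2 + m) π → 1 + m ∈ π → π ≡ 1 + m ∷ [ 1 ]
partition-with-part-n∸1 {m} {x ∷ xs} isP@(_ ∷ positive , _ , sum≡2+m) 1+m∈π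
  with large-part-is-largest isP 1+m∈π (s≤s (m≤n+m (suc m) m))
... | refl = cong (x ∷_) (positive-sum≡1 positive (+-cancelˡ-≡ x (sum xs) 1 (trans sum≡2+m (sym (+-comm x 1)))))

pMex-one-exception : ∀ {A a n π₀} → IsPartition n π₀ → a ∈ π₀ → n < a + A →
                     (∀ {π} → IsPartition n π → a ∈ π → π ≡ π₀) →
                     pMex A a n ≡ p n ∸ 1
pMex-one-exception {A} {a} {n} {π₀} isP₀@(_ , _ , refl) a∈π₀ n<a+A unique = begin
  pMex A a n
    ≡⟨ sym (m+n∸n≡m (pMex A a n) 1) ⟩
  pMex A a n + 1 ∸ 1
    ≡⟨ cong (λ k → pMex A a n + k ∸ 1) (sym (count-partitions isP₀)) ⟩
  pMex A a n + count _≟ₗ_ π₀ (partitions n) ∸ 1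
    ≡⟨ cong (_∸ 1) (length-filter+count _≟ₗ_ (mexCond? A a) ¬mexCond₀ (partitions n) exceptions) ⟩
  p n ∸ 1 ∎
  where
  a+A∉π₀ : a + A ∉ π₀
  a+A∉π₀ a+A∈π₀ = <⇒≱ n<a+A (∈⇒≤-sum a+A∈π₀)
  0<A : 0 < A
  0<A = +-cancelˡ-< a 0 A (subst (_< a + A) (sym (+-identityʳ a)) (≤-<-trans (∈⇒≤-sum a∈π₀) n<a+A))
  ¬mexCond₀ : ¬ MexCond A a π₀
  ¬mexCond₀ = ¬mexCond-second 0<A a∈π₀ a+A∉π₀
  only-exception : ∀ {π} → IsPartition n π → ¬ MexCond A a π → π ≡ π₀
  only-exception {π} isP ¬mexCond with a ∈? π
  ... | yes a∈π = unique isP a∈π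
  ... | no  a∉π = contradiction (mexCond-absent a∉π) ¬mexCond
  exceptions : All (λ π → ¬ MexCond A a π → π ≡ π₀) (partitions n)
  exceptions = All.map only-exception (all-filter (isPartition? n) (candidates n))

theorem5p3 : (n : ℕ) → 2 ≤ n → (pMex n n n ≡ p n ∸ 1) × (pMex n (n ∸ 1) n ≡ p n ∸ 1)
theorem5p3 (suc zero)    (s≤s ())
theorem5p3 (suc (suc m)) _ =
  pMex-one-exception ((s≤s z≤n ∷ []) , [-] , +-identityʳ (2 + m)) (here refl)
                     (m<m+n (2 + m) z<s) partition-with-part-n ,
  pMex-one-exception ((s≤s z≤n ∷ s≤s z≤n ∷ []) , (s≤s z≤n ∷ [-]) , +-comm (1 + m) 1) (here refl)
                     (m<n+m (2 + m) z<s) partition-with-part-n∸1
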